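{- Let $k\geq 2$ and $1\leq i\leq k$ be integers, and consider a restricted lattice path (as defined in the context) starting at $(0,k-i)$ whose peaks all have height at most $k-1$. Then: (1) every peak of charge $j$ has $x$-coordinate at least $j+\max(j-i+1,0)$; (2) if $x^{(a)}$ and $y^{(b)}$ are two peaks, with $x$-coordinates $x>y$ and charges $a$ and $b$ respectively, such that every peak strictly between them has charge lower than $\min(a,b)$ and the charges of these intermediate peaks sum to $c$ (with $c=0$ if there are none, i.e. the peaks are adjacent), then $$x-y\geq 2\min(a,b)+\chi_{a>b}+2c,$$ where $\chi_{a>b}=1$ if $a>b$ and $0$ otherwise.
   Context: Lattice paths live in the first quadrant of the integer lattice. A path starts at a point $(0,h)$ with $h\geq 0$ an integer, ends on the $x$-axis, and each step is either $\alpha:(x,y)\mapsto(x+1,\max(0,y-1))$ or $\beta:(x,y)\mapsto(x+1,y+1)$. A peak is a vertex of the path reached by a $\beta$ step and followed by an $\alpha$ step; its height is its $y$-coordinate and its weight is its $x$-coordinate. The path is restricted if all peaks have height at most $k-1$. The charge of a peak at $(x_0,y_0)$ is the largest integer $c$ such that there are two points $(x',y_0-c)$ and $(x'',y_0-c)$ on the path with $x'<x_0<x''$ such that between these two points there is no peak of height larger than $y_0$ and every peak of height equal to $y_0$ between them has weight larger than $x_0$. A peak with $x$-coordinate $x$ and charge $a$ is denoted $x^{(a)}$. -}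

module Defs where

open import Data.Nat using (ℕ; zero; suc; _+_; _*_; _∸_; _≤_; _<_; _<ᵇ_; _⊓_)
open import Data.Bool using (Bool; true; false; T; if_then_else_)
open import Data.List using (List; []; _∷_; foldl; take; length)
open import Data.Product using (Σ; _×_; ∃-syntax)
open import Relation.Binary.PropositionalEquality using (_≡_)

-- The two kinds of steps.
--   α : (x,y) ↦ (x+1, max(0,y-1))      β : (x,y) ↦ (x+1, y+1)
data Step : Set where
  α β : Step

stepH : ℕ → Step → ℕ
stepH y α = y ∸ 1
stepH y β = suc y

-- A path is given by its starting height h (start point (0,h)) and its list
-- of steps.  The vertex with x-coordinate x (0 ≤ x ≤ length ss) has height
-- hgt h ss x.
hgt : ℕ → List Step → ℕ → ℕ
hgt h ss x = foldl stepH h (take x ss)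

EndsOnAxis : ℕ → List Step → Set
EndsOnAxis h ss = hgt h ss (length ss) ≡ 0

private
  peakPair : Step → List Step → Bool
  peakPair β (α ∷ _) = true
  peakPair _ _       = false

-- isPeak ss x: the vertex with x-coordinate x is reached by a β step
-- (step number x) and followed by an α step (step number x+1).
isPeak : List Step → ℕ → Bool
isPeak []       _             = false
isPeak (s ∷ ss) zero          = false
isPeak (s ∷ ss) (suc zero)    = peakPair s ss
isPeak (s ∷ ss) (suc (suc t)) = isPeak ss (suc t)

IsPeak : List Step → ℕ → Set
IsPeak ss x = T (isPeak ss x)

Restricted : ℕ → ℕ → List Step → Set
Restricted k h ss = ∀ t → IsPeak ss t → hgt h ss t ≤ k ∸ 1

ChargeAdmissible : ℕ → List Step → ℕ → ℕ → Set
ChargeAdmissible h ss x0 c =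
  c ≤ hgt h ss x0 ×
  ∃[ x' ] ∃[ x'' ]
    ( x' < x0 × x0 < x'' × x'' ≤ length ss
    × hgt h ss x' ≡ hgt h ss x0 ∸ c
    × hgt h ss x'' ≡ hgt h ss x0 ∸ c
    × (∀ t → x' < t → t < x'' → IsPeak ss t →
         hgt h ss t ≤ hgt h ss x0
         × (hgt h ss t ≡ hgt h ss x0 → x0 ≤ t)))

IsCharge : ℕ → List Step → ℕ → ℕ → Set
IsCharge h ss x0 c =
  ChargeAdmissible h ss x0 c × (∀ c' → ChargeAdmissible h ss x0 c' → c' ≤ c)

peakSum : List Step → (ℕ → ℕ) → ℕ → ℕ → ℕ
peakSum ss ch lo zero    = 0
peakSum ss ch lo (suc n) =
  (if isPeak ss lo then ch lo else 0) + peakSum ss ch (suc lo) n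

chi : ℕ → ℕ → ℕ
chi a b = if b <ᵇ a then 1 else 0

-- A step changes the height H by at most one. If the peak at x has admissible
-- charge c, the barrier in the definition of the charge forces the path down to
-- the floor H x ∸ c between x and any later peak higher than x, and between x and
-- any earlier peak at least as high as x; so two peaks are always separated by a
-- dip to the floor of one of them.
--
-- (1) The point x′ < x at height H x ∸ c gives c ≤ x − x′ and (k − i) + c − H x ≤ x′.
--
-- (2) Let σ be the sum of the charges of the peaks strictly between u < w. If each
-- of these peaks reaches its floor on both of its sides within [u, w], then
-- w − u ≥ (H u − H p) + (H w − H p) + 2σ for every p in [u, w]: split [u, w] at the
-- inner peak t with the lowest floor, whose excursion from its floor costs 2 c(t),
-- and recurse on both halves, where t is now the endpoint with the lowest floor.
-- Between y and x every inner peak has a smaller charge than both, which provides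
-- the dips, and the dip between y and x reaches the floor of the lower of the two,
-- which accounts for 2 min(a, b) + χ(a > b).

module Submission where

open import Defs
open import Data.Nat
  using (ℕ; zero; suc; _+_; _*_; _∸_; _≤_; _<_; _⊓_; z≤n; s≤s; z<s; _≤?_; _<?_; _<ᵇ_)
open import Data.Nat.Properties
open import Data.Nat.Induction using (<-wellFounded)
open import Data.Nat.Tactic.RingSolver using (solve)
open import Data.List using (List; []; _∷_)
open import Data.Product using (_×_; _,_; proj₁; ∃-syntax)
open import Data.Sum using (_⊎_; inj₁; inj₂; [_,_]′)
open import Data.Bool using (true; false; T; if_then_else_)
open import Data.Unit using (tt)
open import Function using (id)
open import Induction.WellFounded using (Acc; acc)
open import Relation.Nullary using (¬_; yes; no; contradiction)
open import Relation.Nullary.Decidable using (T?; _×-dec_)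
open import Relation.Binary.PropositionalEquality
  using (_≡_; refl; sym; trans; cong; cong₂; subst; module ≡-Reasoning)

min-chi≤ˡ : ∀ a b → 2 * (a ⊓ b) + chi a b ≤ 2 * a
min-chi≤ˡ a b with b <ᵇ a in eq
... | true = begin
  2 * (a ⊓ b) + 1 ≡⟨ cong (λ m → 2 * m + 1) (m≥n⇒m⊓n≡n (<⇒≤ b<a)) ⟩
  2 * b + 1       ≤⟨ +-monoʳ-≤ (2 * b) (n≤1+n 1) ⟩
  2 * b + 2       ≡⟨ solve (b ∷ []) ⟩
  2 * suc b       ≤⟨ *-monoʳ-≤ 2 b<a ⟩
  2 * a           ∎
  where
  open ≤-Reasoning
  b<a = <ᵇ⇒< b a (subst T (sym eq) tt)
... | false = ≤-trans (≤-reflexive (+-identityʳ _)) (*-monoʳ-≤ 2 (m⊓n≤m a b))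

min-chi≤ʳ : ∀ a b → 2 * (a ⊓ b) + chi a b ≤ suc (2 * b)
min-chi≤ʳ a b with b <ᵇ a
... | true = ≤-trans (≤-reflexive (+-comm _ 1)) (s≤s (*-monoʳ-≤ 2 (m⊓n≤n a b)))
... | false = ≤-trans (≤-reflexive (+-identityʳ _)) (m≤n⇒m≤1+n (*-monoʳ-≤ 2 (m⊓n≤n a b)))

suc[j]∸i≤[k∸i]+j∸m : ∀ {k i j m} → 1 ≤ k → i ≤ k → m ≤ k ∸ 1 →
  suc j ∸ i ≤ (k ∸ i) + j ∸ m
suc[j]∸i≤[k∸i]+j∸m {suc k} {i} {j} {m} _ i≤k m≤k = begin
  suc j ∸ i                 ≡⟨ [m+n]∸[m+o]≡n∸o k (suc j) i ⟨
  (k + suc j) ∸ (k + i)     ≡⟨ cong₂ _∸_ (+-suc k j) (+-comm k i) ⟩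
  (suc k + j) ∸ (i + k)     ≡⟨ ∸-+-assoc (suc k + j) i k ⟨
  (suc k + j) ∸ i ∸ k       ≡⟨ cong (_∸ k) (+-∸-comm j i≤k) ⟩
  (suc k ∸ i) + j ∸ k       ≤⟨ ∸-monoʳ-≤ _ m≤k ⟩
  (suc k ∸ i) + j ∸ m       ∎
  where open ≤-Reasoning

merge-bounds : ∀ a b m s₁ s₂ c u t w x y p →
  a + m + 2 * s₁ + u ≤ t + 2 * x → m + b + 2 * s₂ + t ≤ w + 2 * y → x + y + c ≤ p + m →
  a + b + 2 * (s₁ + c + s₂) + u ≤ w + 2 * p
merge-bounds a b m s₁ s₂ c u t w x y p left right dip =
  +-cancelʳ-≤ (t + 2 * m) _ _ (begin
    a + b + 2 * (s₁ + c + s₂) + u + (t + 2 * m)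
      ≡⟨ solve (a ∷ b ∷ m ∷ s₁ ∷ s₂ ∷ c ∷ u ∷ t ∷ []) ⟩
    (a + m + 2 * s₁ + u) + (m + b + 2 * s₂ + t) + 2 * c
      ≤⟨ +-monoˡ-≤ (2 * c) (+-mono-≤ left right) ⟩
    (t + 2 * x) + (w + 2 * y) + 2 * c
      ≡⟨ solve (t ∷ x ∷ w ∷ y ∷ c ∷ []) ⟩
    w + t + 2 * (x + y + c)
      ≤⟨ +-monoʳ-≤ (w + t) (*-monoʳ-≤ 2 dip) ⟩
    w + t + 2 * (p + m)
      ≡⟨ solve (w ∷ t ∷ p ∷ m ∷ []) ⟩
    w + 2 * p + (t + 2 * m) ∎)
  where open ≤-Reasoning

rising-pair-≤ : ∀ k q b y x → k ≤ suc (2 * b) → q + b ≤ y → y < x → k + 2 * q ≤ y + x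
rising-pair-≤ k q b y x k≤ floor y<x = begin
  k + 2 * q                ≤⟨ +-monoˡ-≤ (2 * q) k≤ ⟩
  suc (2 * b) + 2 * q      ≡⟨ solve (q ∷ b ∷ []) ⟩
  (q + b) + suc (q + b)    ≤⟨ +-mono-≤ floor (s≤s floor) ⟩
  y + suc y                ≤⟨ +-monoʳ-≤ y y<x ⟩
  y + x                    ∎
  where open ≤-Reasoning

falling-pair-≤ : ∀ k q a y x → k ≤ 2 * a → q + a ≤ x → x ≤ y → k + 2 * q ≤ y + x
falling-pair-≤ k q a y x k≤ floor x≤y = begin
  k + 2 * q              ≤⟨ +-monoˡ-≤ (2 * q) k≤ ⟩
  2 * a + 2 * q          ≡⟨ solve (q ∷ a ∷ []) ⟩
  (q + a) + (q + a)      ≤⟨ +-mono-≤ (≤-trans floor x≤y) floor ⟩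
  y + x                  ∎
  where open ≤-Reasoning

<-suc-cases : ∀ {A : Set} {s n} → (s < n → A) → (s ≡ n → A) → s < suc n → A
<-suc-cases below at s<1+n = [ below , at ]′ (m<1+n⇒m<n∨m≡n s<1+n)

through-point : ∀ {a b m u p w} → a + u ≤ m + p → b + p ≤ m + w → a + b + u ≤ w + 2 * m
through-point {a} {b} {m} {u} {p} {w} down up = +-cancelʳ-≤ p _ _ (begin
  a + b + u + p         ≡⟨ solve (a ∷ b ∷ u ∷ p ∷ []) ⟩
  (a + u) + (b + p)     ≤⟨ +-mono-≤ down up ⟩
  (m + p) + (m + w)     ≡⟨ solve (m ∷ p ∷ w ∷ []) ⟩
  w + 2 * m + p         ∎)
  where open ≤-Reasoning

module _ (ss : List Step) where

  peakSum-+ : ∀ ch lo m n → peakSum ss ch lo (m + n) ≡ peakSum ss ch lo m + peakSum ss ch (lo + m) n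
  peakSum-+ ch lo zero n = cong (λ l → peakSum ss ch l n) (sym (+-identityʳ lo))
  peakSum-+ ch lo (suc m) n = begin
    here + peakSum ss ch (suc lo) (m + n)
      ≡⟨ cong (here +_) (peakSum-+ ch (suc lo) m n) ⟩
    here + (peakSum ss ch (suc lo) m + peakSum ss ch (suc lo + m) n)
      ≡⟨ +-assoc here _ _ ⟨
    here + peakSum ss ch (suc lo) m + peakSum ss ch (suc lo + m) n
      ≡⟨ cong (λ l → here + peakSum ss ch (suc lo) m + peakSum ss ch l n) (+-suc lo m) ⟨
    here + peakSum ss ch (suc lo) m + peakSum ss ch (lo + suc m) n ∎
    where
    open ≡-Reasoning
    here = if isPeak ss lo then ch lo else 0

  peakSum-peak : ∀ ch {lo} n → IsPeak ss lo →
    peakSum ss ch lo (suc n) ≡ ch lo + peakSum ss ch (suc lo) n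
  peakSum-peak ch {lo} n peak with isPeak ss lo
  ... | true = refl

  peakSum-no-peaks : ∀ ch lo n → (∀ t → lo ≤ t → t < lo + n → ¬ IsPeak ss t) →
    peakSum ss ch lo n ≡ 0
  peakSum-no-peaks ch lo zero none = refl
  peakSum-no-peaks ch lo (suc n) none with isPeak ss lo in eq
  ... | true = contradiction (subst T (sym eq) tt) (none lo ≤-refl (m<m+n lo z<s))
  ... | false = peakSum-no-peaks ch (suc lo) n
                  (λ t lo<t t<end → none t (<⇒≤ lo<t) (subst (t <_) (sym (+-suc lo n)) t<end))

  IsLowestPeak : (ℕ → ℕ) → ℕ → ℕ → ℕ → Set
  IsLowestPeak ℓ lo hi t =
    lo ≤ t × t < hi × IsPeak ss t × (∀ s → lo ≤ s → s < hi → IsPeak ss s → ℓ t ≤ ℓ s)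

  lowest-peak : (ℓ : ℕ → ℕ) (lo hi : ℕ) →
    (∀ t → lo ≤ t → t < hi → ¬ IsPeak ss t) ⊎ ∃[ t ] IsLowestPeak ℓ lo hi t
  lowest-peak ℓ lo zero = inj₁ (λ _ _ ())
  lowest-peak ℓ lo (suc hi) with lowest-peak ℓ lo hi | lo ≤? hi ×-dec T? (isPeak ss hi)
  ... | inj₁ none | no ¬cand =
    inj₁ λ s lo≤s → <-suc-cases (none s lo≤s) (λ { refl ps → ¬cand (lo≤s , ps) })
  ... | inj₁ none | yes (lo≤hi , peak) =
    inj₂ (hi , lo≤hi , ≤-refl , peak , λ s lo≤s s<end ps →
      <-suc-cases (λ s<hi → contradiction ps (none s lo≤s s<hi)) (λ { refl → ≤-refl }) s<end)
  ... | inj₂ (t , lo≤t , t<hi , pt , lowest) | no ¬cand =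
    inj₂ (t , lo≤t , m<n⇒m<1+n t<hi , pt , λ s lo≤s →
      <-suc-cases (lowest s lo≤s) (λ { refl ps → contradiction (lo≤s , ps) ¬cand }))
  ... | inj₂ (t , lo≤t , t<hi , pt , lowest) | yes (lo≤hi , peak) with ℓ t ≤? ℓ hi
  ...   | yes t≤hi =
    inj₂ (t , lo≤t , m<n⇒m<1+n t<hi , pt , λ s lo≤s →
      <-suc-cases (lowest s lo≤s) (λ { refl _ → t≤hi }))
  ...   | no t≰hi =
    inj₂ (hi , lo≤hi , ≤-refl , peak , λ s lo≤s →
      <-suc-cases (λ s<hi ps → ≤-trans (<⇒≤ (≰⇒> t≰hi)) (lowest s lo≤s s<hi ps))
                  (λ { refl _ → ≤-refl }))

hgt-suc-≤ : ∀ h ss x → hgt h ss (suc x) ≤ suc (hgt h ss x)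
hgt-suc-≤ h [] zero = n≤1+n h
hgt-suc-≤ h [] (suc x) = n≤1+n h
hgt-suc-≤ h (α ∷ ss) zero = m≤n⇒m≤1+n (m∸n≤m h 1)
hgt-suc-≤ h (β ∷ ss) zero = ≤-refl
hgt-suc-≤ h (s ∷ ss) (suc x) = hgt-suc-≤ (stepH h s) ss x

hgt-≤-suc : ∀ h ss x → hgt h ss x ≤ suc (hgt h ss (suc x))
hgt-≤-suc h [] zero = n≤1+n h
hgt-≤-suc h [] (suc x) = n≤1+n h
hgt-≤-suc h (α ∷ ss) zero = m≤n+m∸n h 1
hgt-≤-suc h (β ∷ ss) zero = m≤n⇒m≤1+n (n≤1+n h)
hgt-≤-suc h (s ∷ ss) (suc x) = hgt-≤-suc (stepH h s) ss x

module Path (h : ℕ) (ss : List Step) where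

  H : ℕ → ℕ
  H = hgt h ss

  rise-≤ : ∀ {u v} → u ≤ v → H v + u ≤ H u + v
  rise-≤ {v = zero} z≤n = ≤-refl
  rise-≤ {u} {suc v} u≤1+v with m≤n⇒m<n∨m≡n u≤1+v
  ... | inj₂ refl = ≤-refl
  ... | inj₁ u<1+v = begin
    H (suc v) + u   ≤⟨ +-monoˡ-≤ u (hgt-suc-≤ h ss v) ⟩
    suc (H v + u)   ≤⟨ s≤s (rise-≤ (m<1+n⇒m≤n u<1+v)) ⟩
    suc (H u + v)   ≡⟨ +-suc (H u) v ⟨
    H u + suc v     ∎
    where open ≤-Reasoning

  fall-≤ : ∀ {u v} → u ≤ v → H u + u ≤ H v + v
  fall-≤ {v = zero} z≤n = ≤-refl
  fall-≤ {u} {suc v} u≤1+v with m≤n⇒m<n∨m≡n u≤1+v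
  ... | inj₂ refl = ≤-refl
  ... | inj₁ u<1+v = begin
    H u + u               ≤⟨ fall-≤ (m<1+n⇒m≤n u<1+v) ⟩
    H v + v               ≤⟨ +-monoˡ-≤ v (hgt-≤-suc h ss v) ⟩
    suc (H (suc v)) + v   ≡⟨ +-suc (H (suc v)) v ⟨
    H (suc v) + suc v     ∎
    where open ≤-Reasoning

  -- w − u ≥ (H u − H p) + (H w − H p) + 2σ for all p in [u, w], with the
  -- subtractions moved to the other side.
  LengthBound : ℕ → ℕ → ℕ → Set
  LengthBound u w σ = ∀ {p} → u ≤ p → p ≤ w → H u + H w + 2 * σ + u ≤ w + 2 * H p

  valley-bound : ∀ {u w} → LengthBound u w 0
  valley-bound {u} {w} {p} u≤p p≤w =
    subst (_≤ w + 2 * H p) (cong (_+ u) (sym (+-identityʳ (H u + H w))))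
      (through-point {H u} {H w} {H p} (fall-≤ u≤p) (rise-≤ p≤w))

  Dip : ℕ → ℕ → ℕ → Set
  Dip u v ℓ = ∃[ p ] (u ≤ p × p ≤ v × H p ≤ ℓ)

  Dip-mono : ∀ {u v ℓ ℓ′} → ℓ ≤ ℓ′ → Dip u v ℓ → Dip u v ℓ′
  Dip-mono ℓ≤ℓ′ (p , u≤p , p≤v , Hp≤ℓ) = p , u≤p , p≤v , ≤-trans Hp≤ℓ ℓ≤ℓ′

  Admissible : ℕ → ℕ → Set
  Admissible = ChargeAdmissible h ss

  below-floor : ∀ x {c} q → c ≤ H x → H q ≤ H x ∸ c → H q + c ≤ H x
  below-floor x {c} _ c≤Hx Hq≤ = ≤-trans (+-monoˡ-≤ c Hq≤) (≤-reflexive (m∸n+n≡m c≤Hx))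

  dip-right : ∀ {x c t} → Admissible x c → x < t → IsPeak ss t → H x < H t → Dip x t (H x ∸ c)
  dip-right {t = t} (_ , x′ , x″ , x′<x , x<x″ , _ , _ , Hx″ , barrier) x<t peak Hx<Ht
    with x″ ≤? t
  ... | yes x″≤t = x″ , <⇒≤ x<x″ , x″≤t , ≤-reflexive Hx″
  ... | no x″≰t =
    contradiction (proj₁ (barrier _ (<-trans x′<x x<t) (≰⇒> x″≰t) peak)) (<⇒≱ Hx<Ht)

  dip-left : ∀ {x c t} → Admissible x c → t < x → IsPeak ss t → H x ≤ H t → Dip t x (H x ∸ c)
  dip-left (_ , x′ , x″ , x′<x , x<x″ , _ , Hx′ , _ , barrier) t<x peak Hx≤Ht with _ ≤? x′
  ... | yes t≤x′ = x′ , t≤x′ , <⇒≤ x′<x , ≤-reflexive Hx′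
  ... | no t≰x′ with barrier _ (≰⇒> t≰x′) (<-trans t<x x<x″) peak
  ...   | Ht≤Hx , tie = contradiction (tie (≤-antisym Ht≤Hx Hx≤Ht)) (<⇒≱ t<x)

  dip-to-floorˡ : ∀ {u v a b} → Admissible u a → Admissible v b →
    u < v → IsPeak ss u → IsPeak ss v →
    a ≤ b → Dip u v (H u ∸ a)
  dip-to-floorˡ {u} {v} adm-u adm-v u<v pu pv a≤b with H u <? H v
  ... | yes Hu<Hv = dip-right adm-u u<v pv Hu<Hv
  ... | no Hu≮Hv = Dip-mono (∸-mono (≮⇒≥ Hu≮Hv) a≤b) (dip-left adm-v u<v pu (≮⇒≥ Hu≮Hv))

  dip-to-floorʳ : ∀ {u v a b} → Admissible u a → Admissible v b →
    u < v → IsPeak ss u → IsPeak ss v →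
    b ≤ a → Dip u v (H v ∸ b)
  dip-to-floorʳ {u} {v} adm-u adm-v u<v pu pv b≤a with H u <? H v
  ... | yes Hu<Hv = Dip-mono (∸-mono (<⇒≤ Hu<Hv) b≤a) (dip-right adm-u u<v pv Hu<Hv)
  ... | no Hu≮Hv = dip-left adm-v u<v pu (≮⇒≥ Hu≮Hv)

  dip-to-some-floor : ∀ {u v a b} → Admissible u a → Admissible v b →
    u < v → IsPeak ss u → IsPeak ss v →
    Dip u v (H u ∸ a) ⊎ Dip u v (H v ∸ b)
  dip-to-some-floor {u} {v} adm-u adm-v u<v pu pv with H u <? H v
  ... | yes Hu<Hv = inj₁ (dip-right adm-u u<v pv Hu<Hv)
  ... | no Hu≮Hv = inj₂ (dip-left adm-v u<v pu (≮⇒≥ Hu≮Hv))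

  two-peak-dip : ∀ {y x b a} → Admissible y b → Admissible x a →
    y < x → IsPeak ss y → IsPeak ss x →
    ∃[ q ] (y ≤ q × q ≤ x × 2 * (a ⊓ b) + chi a b + 2 * H q ≤ H y + H x)
  two-peak-dip {y} {x} {b} {a} adm-y adm-x y<x py px with H y <? H x
  ... | yes Hy<Hx =
    let (q , y≤q , q≤x , Hq≤) = dip-right adm-y y<x px Hy<Hx in
    q , y≤q , q≤x ,
    rising-pair-≤ _ (H q) b (H y) (H x) (min-chi≤ʳ a b) (below-floor y q (proj₁ adm-y) Hq≤) Hy<Hx
  ... | no Hy≮Hx =
    let (q , y≤q , q≤x , Hq≤) = dip-left adm-x y<x py (≮⇒≥ Hy≮Hx) in
    q , y≤q , q≤x ,
    falling-pair-≤ _ (H q) a (H y) (H x) (min-chi≤ˡ a b) (below-floor x q (proj₁ adm-x) Hq≤)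
      (≮⇒≥ Hy≮Hx)

  charged-peak-position : ∀ {x j} → Admissible x j → j + (h + j ∸ H x) ≤ x
  charged-peak-position {x} {j} (j≤Hx , x′ , _ , x′<x , _ , _ , Hx′ , _) = begin
    j + (h + j ∸ H x)  ≤⟨ +-monoʳ-≤ j (m≤n+o⇒m∸n≤o (h + j) (H x) from-origin) ⟩
    j + x′             ≤⟨ +-cancelˡ-≤ (H x ∸ j) _ _ to-peak ⟩
    x                  ∎
    where
    open ≤-Reasoning
    restore : H x′ + j ≡ H x
    restore = trans (cong (_+ j) Hx′) (m∸n+n≡m j≤Hx)
    from-origin : h + j ≤ H x + x′
    from-origin = begin
      h + j            ≡⟨ cong (_+ j) (+-identityʳ h) ⟨
      h + 0 + j        ≤⟨ +-monoˡ-≤ j (fall-≤ {v = x′} z≤n) ⟩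
      H x′ + x′ + j    ≡⟨ +-assoc (H x′) x′ j ⟩
      H x′ + (x′ + j)  ≡⟨ cong (H x′ +_) (+-comm x′ j) ⟩
      H x′ + (j + x′)  ≡⟨ +-assoc (H x′) j x′ ⟨
      H x′ + j + x′    ≡⟨ cong (_+ x′) restore ⟩
      H x + x′         ∎
    to-peak : (H x ∸ j) + (j + x′) ≤ (H x ∸ j) + x
    to-peak = begin
      (H x ∸ j) + (j + x′)  ≡⟨ +-assoc (H x ∸ j) j x′ ⟨
      (H x ∸ j) + j + x′    ≡⟨ cong (_+ x′) (m∸n+n≡m j≤Hx) ⟩
      H x + x′              ≤⟨ rise-≤ (<⇒≤ x′<x) ⟩
      H x′ + x              ≡⟨ cong (_+ x) Hx′ ⟩
      (H x ∸ j) + x         ∎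

  chargeBetween : (ℕ → ℕ) → ℕ → ℕ → ℕ
  chargeBetween ch u w = peakSum ss ch (suc u) (w ∸ suc u)

  chargeBetween-none : ∀ ch {u w} → u < w → (∀ t → u < t → t < w → ¬ IsPeak ss t) →
    chargeBetween ch u w ≡ 0
  chargeBetween-none ch {u} u<w none =
    peakSum-no-peaks ss ch (suc u) _ (λ t u<t t<end → none t u<t (subst (t <_) (m+[n∸m]≡n u<w) t<end))

  chargeBetween-split : ∀ ch {u t w} → u < t → t < w → IsPeak ss t →
    chargeBetween ch u w ≡ chargeBetween ch u t + ch t + chargeBetween ch t w
  chargeBetween-split ch {u} {t} {w} u<t t<w peak = begin
    peakSum ss ch (suc u) (w ∸ suc u)
      ≡⟨ cong (peakSum ss ch (suc u)) lengths ⟩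
    peakSum ss ch (suc u) ((t ∸ suc u) + (w ∸ t))
      ≡⟨ peakSum-+ ss ch (suc u) (t ∸ suc u) (w ∸ t) ⟩
    chargeBetween ch u t + peakSum ss ch (suc u + (t ∸ suc u)) (w ∸ t)
      ≡⟨ cong₂ (λ l n → chargeBetween ch u t + peakSum ss ch l n)
               (m+[n∸m]≡n u<t) (+-∸-assoc 1 t<w) ⟩
    chargeBetween ch u t + peakSum ss ch t (suc (w ∸ suc t))
      ≡⟨ cong (chargeBetween ch u t +_) (peakSum-peak ss ch (w ∸ suc t) peak) ⟩
    chargeBetween ch u t + (ch t + chargeBetween ch t w)
      ≡⟨ +-assoc (chargeBetween ch u t) (ch t) _ ⟨
    chargeBetween ch u t + ch t + chargeBetween ch t w ∎
    where
    open ≡-Reasoning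
    lengths : w ∸ suc u ≡ (t ∸ suc u) + (w ∸ t)
    lengths = begin
      w ∸ suc u               ≡⟨ cong (_∸ suc u) (m∸n+n≡m (<⇒≤ t<w)) ⟨
      (w ∸ t) + t ∸ suc u     ≡⟨ +-∸-assoc (w ∸ t) u<t ⟩
      (w ∸ t) + (t ∸ suc u)   ≡⟨ +-comm (w ∸ t) _ ⟩
      (t ∸ suc u) + (w ∸ t)   ∎

  module _ (ch ℓ : ℕ → ℕ) where

    FloorsReached : ℕ → ℕ → Set
    FloorsReached u w =
      ∀ t → u < t → t < w → IsPeak ss t → ℓ t + ch t ≤ H t × Dip u t (ℓ t) × Dip t w (ℓ t)

    PeaksSeparated : ℕ → ℕ → Set
    PeaksSeparated u w =
      ∀ s t → u < s → s < t → t < w → IsPeak ss s → IsPeak ss t → Dip s t (ℓ s) ⊎ Dip s t (ℓ t)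

    LengthBound-merge : ∀ {u t w σ₁ σ₂} → ℓ t + ch t ≤ H t → Dip u t (ℓ t) → Dip t w (ℓ t) →
      LengthBound u t σ₁ → LengthBound t w σ₂ → LengthBound u w (σ₁ + ch t + σ₂)
    LengthBound-merge {u} {t} {w} {σ₁} {σ₂} floor
      (q₁ , u≤q₁ , q₁≤t , Hq₁≤) (q₂ , t≤q₂ , q₂≤w , Hq₂≤)
      left right {p} u≤p p≤w = [ left-of-peak , right-of-peak ]′ (≤-total p t)
      where
      open ≤-Reasoning
      reaches-floor : ∀ q → H q ≤ ℓ t → H q + ch t ≤ H t
      reaches-floor _ Hq≤ = ≤-trans (+-monoˡ-≤ (ch t) Hq≤) floor
      join : ∀ {x y} → u ≤ x → x ≤ t → t ≤ y → y ≤ w → H x + H y + ch t ≤ H p + H t →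
        H u + H w + 2 * (σ₁ + ch t + σ₂) + u ≤ w + 2 * H p
      join {x} {y} u≤x x≤t t≤y y≤w =
        merge-bounds (H u) (H w) (H t) σ₁ σ₂ (ch t) u t w (H x) (H y) (H p)
          (left u≤x x≤t) (right t≤y y≤w)
      left-of-peak : p ≤ t → H u + H w + 2 * (σ₁ + ch t + σ₂) + u ≤ w + 2 * H p
      left-of-peak p≤t = join u≤p p≤t t≤q₂ q₂≤w (begin
        H p + H q₂ + ch t    ≡⟨ +-assoc (H p) (H q₂) (ch t) ⟩
        H p + (H q₂ + ch t)  ≤⟨ +-monoʳ-≤ (H p) (reaches-floor q₂ Hq₂≤) ⟩
        H p + H t            ∎)
      right-of-peak : t ≤ p → H u + H w + 2 * (σ₁ + ch t + σ₂) + u ≤ w + 2 * H p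
      right-of-peak t≤p = join u≤q₁ q₁≤t t≤p p≤w (begin
        H q₁ + H p + ch t    ≡⟨ cong (_+ ch t) (+-comm (H q₁) (H p)) ⟩
        H p + H q₁ + ch t    ≡⟨ +-assoc (H p) (H q₁) (ch t) ⟩
        H p + (H q₁ + ch t)  ≤⟨ +-monoʳ-≤ (H p) (reaches-floor q₁ Hq₁≤) ⟩
        H p + H t            ∎)

    FloorsReached-left : ∀ {u t w} → FloorsReached u w → PeaksSeparated u w → t < w → IsPeak ss t →
      (∀ s → u < s → s < w → IsPeak ss s → ℓ t ≤ ℓ s) → FloorsReached u t
    FloorsReached-left floors separated t<w pt lowest s u<s s<t ps with floors s u<s (<-trans s<t t<w) ps
    ... | floor , dipˡ , _ =
      floor , dipˡ ,
      [ id , Dip-mono (lowest s u<s (<-trans s<t t<w) ps) ]′ (separated s _ u<s s<t t<w ps pt)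

    FloorsReached-right : ∀ {u t w} → FloorsReached u w → PeaksSeparated u w → u < t → IsPeak ss t →
      (∀ s → u < s → s < w → IsPeak ss s → ℓ t ≤ ℓ s) → FloorsReached t w
    FloorsReached-right floors separated u<t pt lowest s t<s s<w ps with floors s (<-trans u<t t<s) s<w ps
    ... | floor , _ , dipʳ =
      floor ,
      [ Dip-mono (lowest s (<-trans u<t t<s) s<w ps) , id ]′ (separated _ s u<t t<s s<w pt ps) ,
      dipʳ

    PeaksSeparated-left : ∀ {u t w} → PeaksSeparated u w → t ≤ w → PeaksSeparated u t
    PeaksSeparated-left separated t≤w s s′ u<s s<s′ s′<t =
      separated s s′ u<s s<s′ (<-≤-trans s′<t t≤w)

    PeaksSeparated-right : ∀ {u t w} → PeaksSeparated u w → u ≤ t → PeaksSeparated t w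
    PeaksSeparated-right separated u≤t s s′ t<s = separated s s′ (≤-<-trans u≤t t<s)

    charges-between-≤ : ∀ {u w} → u < w → FloorsReached u w → PeaksSeparated u w →
      LengthBound u w (chargeBetween ch u w)
    charges-between-≤ {u} {w} = go (<-wellFounded (w ∸ u))
      where
      go : ∀ {u w} → Acc _<_ (w ∸ u) → u < w → FloorsReached u w → PeaksSeparated u w →
        LengthBound u w (chargeBetween ch u w)
      go {u} {w} (acc smaller) u<w floors separated with lowest-peak ss ℓ (suc u) w
      ... | inj₁ none = subst (LengthBound u w) (sym (chargeBetween-none ch u<w none)) valley-bound
      ... | inj₂ (t , u<t , t<w , peak , lowest) with floors t u<t t<w peak
      ...   | floor , dipˡ , dipʳ =
        subst (LengthBound u w) (sym (chargeBetween-split ch u<t t<w peak))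
          (LengthBound-merge {σ₁ = chargeBetween ch u t} {σ₂ = chargeBetween ch t w} floor dipˡ dipʳ
            (go (smaller (∸-monoˡ-< t<w (<⇒≤ u<t))) u<t
                (FloorsReached-left floors separated t<w peak lowest)
                (PeaksSeparated-left separated (<⇒≤ t<w)))
            (go (smaller (∸-monoʳ-< u<t (<⇒≤ t<w))) t<w
                (FloorsReached-right floors separated u<t peak lowest)
                (PeaksSeparated-right separated (<⇒≤ u<t))))

  charged-peaks-gap : (ch : ℕ → ℕ) → (∀ t → IsPeak ss t → Admissible t (ch t)) →
    ∀ {x y} → y < x → IsPeak ss x → IsPeak ss y →
    (∀ t → y < t → t < x → IsPeak ss t → ch t ≤ ch x ⊓ ch y) →
    y + (2 * (ch x ⊓ ch y) + chi (ch x) (ch y) + 2 * chargeBetween ch y x) ≤ x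
  charged-peaks-gap ch admissible {x} {y} y<x px py lighter
    with two-peak-dip (admissible y py) (admissible x px) y<x py px
  ... | q , y≤q , q≤x , pair≤ = +-cancelʳ-≤ (2 * H q) _ _ (begin
    y + (κ + 2 * σ) + 2 * H q   ≡⟨ shuffle y κ σ (H q) ⟩
    κ + 2 * H q + 2 * σ + y     ≤⟨ +-monoˡ-≤ y (+-monoˡ-≤ (2 * σ) pair≤) ⟩
    H y + H x + 2 * σ + y       ≤⟨ charges-between-≤ ch floor y<x floors separated y≤q q≤x ⟩
    x + 2 * H q                 ∎)
    where
    open ≤-Reasoning
    κ = 2 * (ch x ⊓ ch y) + chi (ch x) (ch y)
    σ = chargeBetween ch y x
    shuffle : ∀ a b c d → a + (b + 2 * c) + 2 * d ≡ b + 2 * d + 2 * c + a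
    shuffle a b c d = solve (a ∷ b ∷ c ∷ d ∷ [])
    floor : ℕ → ℕ
    floor t = H t ∸ ch t
    floors : FloorsReached ch floor y x
    floors t y<t t<x pt =
      ≤-reflexive (m∸n+n≡m (proj₁ (admissible t pt))) ,
      dip-to-floorʳ (admissible y py) (admissible t pt) y<t py pt
        (≤-trans (lighter t y<t t<x pt) (m⊓n≤n _ _)) ,
      dip-to-floorˡ (admissible t pt) (admissible x px) t<x pt px
        (≤-trans (lighter t y<t t<x pt) (m⊓n≤m _ _))
    separated : PeaksSeparated ch floor y x
    separated s t _ s<t _ ps pt = dip-to-some-floor (admissible s ps) (admissible t pt) s<t ps pt

lemma1 : (k i : ℕ) → 2 ≤ k → 1 ≤ i → i ≤ k →
    (ss : List Step) → EndsOnAxis (k ∸ i) ss → Restricted k (k ∸ i) ss →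
    ((x j : ℕ) → IsPeak ss x → IsCharge (k ∸ i) ss x j →
       j + (suc j ∸ i) ≤ x)
    ×
    ((ch : ℕ → ℕ) → ((t : ℕ) → IsPeak ss t → IsCharge (k ∸ i) ss t (ch t)) →
     (x y : ℕ) → y < x → IsPeak ss x → IsPeak ss y →
     ((t : ℕ) → y < t → t < x → IsPeak ss t → ch t < ch x ⊓ ch y) →
     y + (2 * (ch x ⊓ ch y) + chi (ch x) (ch y)
          + 2 * peakSum ss ch (suc y) (x ∸ suc y)) ≤ x)
lemma1 k i 2≤k _ i≤k ss _ restricted =
  (λ x j peak (admissible , _) →
     ≤-trans (+-monoʳ-≤ j (suc[j]∸i≤[k∸i]+j∸m (<⇒≤ 2≤k) i≤k (restricted x peak)))
             (charged-peak-position admissible)) ,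
  (λ ch charge x y y<x px py lower →
     charged-peaks-gap ch (λ t pt → proj₁ (charge t pt)) y<x px py
       (λ t y<t t<x pt → <⇒≤ (lower t y<t t<x pt)))
  where open Path (k ∸ i) ss
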